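{- Let $G$ be a finite simple graph. If $G$ contains three cutvertices lying in the same connected component, then it is not the case that both $G$ and $\overline{G}$ are distance-hereditary.
   Context: A cutvertex is a vertex whose deletion increases the number of connected components. A graph is distance-hereditary if it contains no induced hole (cycle of length at least $5$), house ($4$-cycle plus a vertex adjacent to exactly two adjacent vertices of the cycle), domino (two $4$-cycles sharing an edge), or gem ($P_4$ plus a vertex adjacent to all its vertices). -}

module Defs where

open import Data.Nat using (ℕ; zero; suc; _≤_; _<_; _≡ᵇ_)
open import Data.Fin using (Fin; toℕ; punchIn; _≟_)
open import Data.Bool using (Bool; true; false; not; _∨_; _∧_; if_then_else_)
open import Data.Bool.Properties using (∨-comm)
open import Data.List using (List; []; _∷_)
open import Data.Product using (Σ; ∃; _×_; _,_)
open import Relation.Nullary using (¬_; yes; no; does)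
open import Relation.Binary.PropositionalEquality using (_≡_; refl; sym; cong; cong₂)

record Graph (n : ℕ) : Set where
  field
    adj    : Fin n → Fin n → Bool
    adj-sym : ∀ i j → adj i j ≡ adj j i
    adj-irr : ∀ i → adj i i ≡ false
open Graph public

complement : ∀ {n} → Graph n → Graph n
complement {n} G = record { adj = cadj ; adj-sym = csym ; adj-irr = cirr }
  where
  cadj : Fin n → Fin n → Bool
  cadj i j = if does (i ≟ j) then false else not (adj G i j)
  csym : ∀ i j → cadj i j ≡ cadj j i
  csym i j with i ≟ j | j ≟ i
  ... | yes _ | yes _ = refl
  ... | yes p | no q = Data.Empty.⊥-elim (q (sym p))
    where import Data.Empty
  ... | no q | yes p = Data.Empty.⊥-elim (q (sym p))
    where import Data.Empty
  ... | no _ | no _ = cong not (adj-sym G i j)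
  cirr : ∀ i → cadj i i ≡ false
  cirr i with i ≟ i
  ... | yes _ = refl
  ... | no q = Data.Empty.⊥-elim (q refl)
    where import Data.Empty

deleteVertex : ∀ {m} → Graph (suc m) → Fin (suc m) → Graph m
deleteVertex G v = record
  { adj = λ i j → adj G (punchIn v i) (punchIn v j)
  ; adj-sym = λ i j → adj-sym G (punchIn v i) (punchIn v j)
  ; adj-irr = λ i → adj-irr G (punchIn v i) }

data Reachable {n} (G : Graph n) : Fin n → Fin n → Set where
  here : ∀ {u} → Reachable G u u
  step : ∀ {u v w} → adj G u v ≡ true → Reachable G v w → Reachable G u w

-- G has exactly k connected components: there is a surjection from the
-- vertices onto Fin k identifying exactly the vertices in the same
-- component (i.e. a bijection between the components and Fin k).
HasComponents : ∀ {n} → Graph n → ℕ → Set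
HasComponents {n} G k =
  Σ (Fin n → Fin k) λ f →
    (∀ c → ∃ λ u → f u ≡ c) ×
    (∀ u v → (f u ≡ f v → Reachable G u v) × (Reachable G u v → f u ≡ f v))

IsCutvertex : ∀ {n} → Graph n → Fin n → Set
IsCutvertex {zero} G ()
IsCutvertex {suc m} G v =
  Σ ℕ λ k → Σ ℕ λ k' →
    HasComponents G k × HasComponents (deleteVertex G v) k' × k < k'

ContainsInduced : ∀ {n} → Graph n → (k : ℕ) → (Fin k → Fin k → Bool) → Set
ContainsInduced {n} G k h =
  Σ (Fin k → Fin n) λ f →
    (∀ i j → f i ≡ f j → i ≡ j) ×
    (∀ i j → h i j ≡ adj G (f i) (f j))

edgeAdj : ∀ {k} → List (ℕ × ℕ) → Fin k → Fin k → Bool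
edgeAdj [] i j = false
edgeAdj ((a , b) ∷ es) i j =
  ((toℕ i ≡ᵇ a) ∧ (toℕ j ≡ᵇ b)) ∨ ((toℕ i ≡ᵇ b) ∧ (toℕ j ≡ᵇ a)) ∨ edgeAdj es i j

cycleAdj : (k : ℕ) → Fin k → Fin k → Bool
cycleAdj k i j =
  (suc (toℕ i) ≡ᵇ toℕ j) ∨ (suc (toℕ j) ≡ᵇ toℕ i) ∨
  ((toℕ i ≡ᵇ 0) ∧ (suc (toℕ j) ≡ᵇ k)) ∨ ((toℕ j ≡ᵇ 0) ∧ (suc (toℕ i) ≡ᵇ k))

houseAdj : Fin 5 → Fin 5 → Bool
houseAdj = edgeAdj ((0 , 1) ∷ (1 , 2) ∷ (2 , 3) ∷ (3 , 0) ∷ (4 , 0) ∷ (4 , 1) ∷ [])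

dominoAdj : Fin 6 → Fin 6 → Bool
dominoAdj = edgeAdj ((0 , 1) ∷ (1 , 2) ∷ (2 , 3) ∷ (3 , 4) ∷ (4 , 5) ∷ (5 , 0) ∷ (1 , 4) ∷ [])

gemAdj : Fin 5 → Fin 5 → Bool
gemAdj = edgeAdj ((0 , 1) ∷ (1 , 2) ∷ (2 , 3) ∷ (4 , 0) ∷ (4 , 1) ∷ (4 , 2) ∷ (4 , 3) ∷ [])

DistanceHereditary : ∀ {n} → Graph n → Set
DistanceHereditary G =
  (∀ k → 5 ≤ k → ¬ ContainsInduced G k (cycleAdj k)) ×
  ¬ ContainsInduced G 5 houseAdj ×
  ¬ ContainsInduced G 6 dominoAdj ×
  ¬ ContainsInduced G 5 gemAdj

-- Only two properties of the complement are used: it has no induced house and no induced gem,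
-- i.e. G has no induced P₅ and no induced P₄ + K₁.  Without an induced P₅, any two vertices of a
-- component are joined by a walk of length at most 3.  A cutvertex z separates two of its
-- neighbours, so for every vertex y it has a neighbour that it separates from y.
-- If one of the three cutvertices, say a, separates the other two, pick such neighbours e of b
-- and f of c away from a: each of a, b, c separates e from f, so all three are interior
-- vertices of a short e–f walk, which has at most two.  Otherwise pick such neighbours pa, pb,
-- pc away from b, a, a: both b and c separate pb from pc, so they are adjacent, and
-- pb b c pc together with pa is an induced P₄ + K₁.
module Submission where

open import Defs
open import Data.Nat using (ℕ; suc; s≤s)
open import Data.Fin using (Fin; suc; _<_; _≟_; punchIn; punchOut)
open import Data.Fin.Patterns using (0F; 1F; 2F; 3F; 4F)
open import Data.Fin.Properties
  using (<-cmp; all?; pigeonhole; <⇒≢; punchInᵢ≢i; punchIn-punchOut; punchOut-punchIn; punchOut-cong)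
open import Data.Bool using (Bool; true; false; not)
open import Data.Bool.Properties using (¬-not)
import Data.Bool.Properties as Bool
open import Data.Unit using (tt)
open import Data.Product using (∃; ∃₂; _×_; _,_; proj₁; proj₂)
open import Data.Sum using (_⊎_; inj₁; inj₂)
open import Data.Empty using (⊥; ⊥-elim)
open import Function using (case_of_; _∘_)
open import Relation.Binary using (tri<; tri≈; tri>)
open import Relation.Nullary using (¬_; yes; no)
open import Relation.Nullary.Decidable using (¬¬-excluded-middle; toWitness)
open import Relation.Binary.PropositionalEquality
  using (_≡_; _≢_; refl; sym; trans; cong; subst; subst₂; ≢-sym; module ≡-Reasoning)

Realises : ∀ {n} → Graph n → Bool → Fin n → Fin n → Set
Realises H b x y = adj H x y ≡ b × x ≢ y

Realises-sym : ∀ {n} (H : Graph n) {b x y} → Realises H b x y → Realises H b y x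
Realises-sym H {x = x} {y} (xy , x≢y) = trans (adj-sym H y x) xy , ≢-sym x≢y

containsInduced-fromUpper : ∀ {n k} (H : Graph n) {h : Fin k → Fin k → Bool} →
  (∀ i j → h i j ≡ h j i) → (∀ i → h i i ≡ false) → (v : Fin k → Fin n) →
  (∀ {i j} → i < j → Realises H (h i j) (v i) (v j)) →
  ContainsInduced H k h
containsInduced-fromUpper H {h} h-sym h-irr v upper = v , injective , agrees
  where
  injective : ∀ i j → v i ≡ v j → i ≡ j
  injective i j vi≡vj with <-cmp i j
  ... | tri< i<j _ _ = ⊥-elim (proj₂ (upper i<j) vi≡vj)
  ... | tri≈ _ i≡j _ = i≡j
  ... | tri> _ _ j<i = ⊥-elim (proj₂ (upper j<i) (sym vi≡vj))
  agrees : ∀ i j → h i j ≡ adj H (v i) (v j)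
  agrees i j with <-cmp i j
  ... | tri< i<j _ _ = sym (proj₁ (upper i<j))
  ... | tri≈ _ refl _ = trans (h-irr i) (sym (adj-irr H (v i)))
  ... | tri> _ _ j<i = begin
    h i j              ≡⟨ h-sym i j ⟩
    h j i              ≡⟨ sym (proj₁ (upper j<i)) ⟩
    adj H (v j) (v i)  ≡⟨ adj-sym H (v j) (v i) ⟩
    adj H (v i) (v j)  ∎
    where open ≡-Reasoning

pairs₅ : {P : Fin 5 → Fin 5 → Set} →
  P 0F 1F → P 0F 2F → P 0F 3F → P 0F 4F → P 1F 2F →
  P 1F 3F → P 1F 4F → P 2F 3F → P 2F 4F → P 3F 4F →
  ∀ {i j} → i < j → P i j
pairs₅ {P} p₀₁ p₀₂ p₀₃ p₀₄ p₁₂ p₁₃ p₁₄ p₂₃ p₂₄ p₃₄ = pair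
  where
  pair : ∀ {i j} → i < j → P i j
  pair {0F} {1F} _ = p₀₁
  pair {0F} {2F} _ = p₀₂
  pair {0F} {3F} _ = p₀₃
  pair {0F} {4F} _ = p₀₄
  pair {1F} {2F} _ = p₁₂
  pair {1F} {3F} _ = p₁₃
  pair {1F} {4F} _ = p₁₄
  pair {2F} {3F} _ = p₂₃
  pair {2F} {4F} _ = p₂₄
  pair {3F} {4F} _ = p₃₄
  pair {_} {0F} ()
  pair {suc _} {1F} (s≤s ())
  pair {suc (suc _)} {2F} (s≤s (s≤s ()))
  pair {suc (suc (suc _))} {3F} (s≤s (s≤s (s≤s ())))
  pair {4F} {4F} (s≤s (s≤s (s≤s (s≤s ()))))

adj⇒≢ : ∀ {n} (H : Graph n) {x y} → adj H x y ≡ true → x ≢ y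
adj⇒≢ H {x} xy refl with () ← trans (sym xy) (adj-irr H x)

houseAdj-sym : ∀ i j → houseAdj i j ≡ houseAdj j i
houseAdj-sym = toWitness {a? = all? λ i → all? λ j → houseAdj i j Bool.≟ houseAdj j i} tt

gemAdj-sym : ∀ i j → gemAdj i j ≡ gemAdj j i
gemAdj-sym = toWitness {a? = all? λ i → all? λ j → gemAdj i j Bool.≟ gemAdj j i} tt

houseAdj-irr : ∀ i → houseAdj i i ≡ false
houseAdj-irr = toWitness {a? = all? λ i → houseAdj i i Bool.≟ false} tt

gemAdj-irr : ∀ i → gemAdj i i ≡ false
gemAdj-irr = toWitness {a? = all? λ i → gemAdj i i Bool.≟ false} tt

module _ {n : ℕ} (G : Graph n) where

  private
    Ḡ : Graph n
    Ḡ = complement G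

  adjᶜ : ∀ {x y} → x ≢ y → adj Ḡ x y ≡ not (adj G x y)
  adjᶜ {x} {y} x≢y with x ≟ y
  ... | yes x≡y = ⊥-elim (x≢y x≡y)
  ... | no _ = refl

  ¬adj⇒adjᶜ : ∀ {x y} → x ≢ y → adj G x y ≢ true → adj Ḡ x y ≡ true
  ¬adj⇒adjᶜ x≢y ¬xy = trans (adjᶜ x≢y) (cong not (¬-not ¬xy))

  adj⇒realisesᶜ : ∀ {x y} → adj G x y ≡ true → Realises Ḡ false x y
  adj⇒realisesᶜ xy = trans (adjᶜ (adj⇒≢ G xy)) (cong not xy) , adj⇒≢ G xy

  adjᶜ⇒realisesᶜ : ∀ {x y} → adj Ḡ x y ≡ true → Realises Ḡ true x y
  adjᶜ⇒realisesᶜ x̄y = x̄y , adj⇒≢ Ḡ x̄y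

  -- The complement of the house is the path 0 2 4 3 1.
  inducedP₅⇒houseᶜ : ∀ {v₀ v₁ v₂ v₃ v₄} →
    adj G v₀ v₁ ≡ true → adj G v₁ v₂ ≡ true → adj G v₂ v₃ ≡ true → adj G v₃ v₄ ≡ true →
    adj Ḡ v₀ v₂ ≡ true → adj Ḡ v₀ v₃ ≡ true → adj Ḡ v₀ v₄ ≡ true →
    adj Ḡ v₁ v₃ ≡ true → adj Ḡ v₁ v₄ ≡ true → adj Ḡ v₂ v₄ ≡ true →
    ContainsInduced Ḡ 5 houseAdj
  inducedP₅⇒houseᶜ {v₀} {v₁} {v₂} {v₃} {v₄} e₀₁ e₁₂ e₂₃ e₃₄ ē₀₂ ē₀₃ ē₀₄ ē₁₃ ē₁₄ ē₂₄ =
    containsInduced-fromUpper Ḡ houseAdj-sym houseAdj-irr v upper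
    where
    v : Fin 5 → Fin n
    v = λ { 0F → v₀ ; 1F → v₄ ; 2F → v₁ ; 3F → v₃ ; 4F → v₂ }
    upper : ∀ {i j} → i < j → Realises Ḡ (houseAdj i j) (v i) (v j)
    upper = pairs₅ {λ i j → Realises Ḡ (houseAdj i j) (v i) (v j)}
      (adjᶜ⇒realisesᶜ ē₀₄) (adj⇒realisesᶜ e₀₁) (adjᶜ⇒realisesᶜ ē₀₃) (adjᶜ⇒realisesᶜ ē₀₂)
      (Realises-sym Ḡ (adjᶜ⇒realisesᶜ ē₁₄)) (Realises-sym Ḡ (adj⇒realisesᶜ e₃₄))
      (Realises-sym Ḡ (adjᶜ⇒realisesᶜ ē₂₄)) (adjᶜ⇒realisesᶜ ē₁₃)
      (adj⇒realisesᶜ e₁₂) (Realises-sym Ḡ (adj⇒realisesᶜ e₂₃))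

  -- The complement of the gem is the path 2 0 3 1 plus the isolated vertex 4.
  inducedP₄+K₁⇒gemᶜ : ∀ {p₀ p₁ p₂ p₃ t} →
    adj G p₀ p₁ ≡ true → adj G p₁ p₂ ≡ true → adj G p₂ p₃ ≡ true →
    adj Ḡ p₀ p₂ ≡ true → adj Ḡ p₀ p₃ ≡ true → adj Ḡ p₁ p₃ ≡ true →
    adj Ḡ t p₀ ≡ true → adj Ḡ t p₁ ≡ true → adj Ḡ t p₂ ≡ true → adj Ḡ t p₃ ≡ true →
    ContainsInduced Ḡ 5 gemAdj
  inducedP₄+K₁⇒gemᶜ {p₀} {p₁} {p₂} {p₃} {t} e₀₁ e₁₂ e₂₃ ē₀₂ ē₀₃ ē₁₃ ēt₀ ēt₁ ēt₂ ēt₃ =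
    containsInduced-fromUpper Ḡ gemAdj-sym gemAdj-irr v upper
    where
    v : Fin 5 → Fin n
    v = λ { 0F → p₁ ; 1F → p₃ ; 2F → p₀ ; 3F → p₂ ; 4F → t }
    upper : ∀ {i j} → i < j → Realises Ḡ (gemAdj i j) (v i) (v j)
    upper = pairs₅ {λ i j → Realises Ḡ (gemAdj i j) (v i) (v j)}
      (adjᶜ⇒realisesᶜ ē₁₃) (Realises-sym Ḡ (adj⇒realisesᶜ e₀₁)) (adj⇒realisesᶜ e₁₂)
      (Realises-sym Ḡ (adjᶜ⇒realisesᶜ ēt₁)) (Realises-sym Ḡ (adjᶜ⇒realisesᶜ ē₀₃))
      (Realises-sym Ḡ (adj⇒realisesᶜ e₂₃)) (Realises-sym Ḡ (adjᶜ⇒realisesᶜ ēt₃))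
      (adjᶜ⇒realisesᶜ ē₀₂) (Realises-sym Ḡ (adjᶜ⇒realisesᶜ ēt₀))
      (Realises-sym Ḡ (adjᶜ⇒realisesᶜ ēt₂))

  data Adjacency (x y : Fin n) : Set where
    same : x ≡ y → Adjacency x y
    edge : adj G x y ≡ true → Adjacency x y
    non-edge : adj Ḡ x y ≡ true → Adjacency x y

  adjacency : ∀ x y → Adjacency x y
  adjacency x y = case x ≟ y of λ where
    (yes x≡y) → same x≡y
    (no x≢y) → case adj G x y Bool.≟ true of λ where
      (yes xy) → edge xy
      (no ¬xy) → non-edge (¬adj⇒adjᶜ x≢y ¬xy)

  reachable-trans : ∀ {x y z} → Reachable G x y → Reachable G y z → Reachable G x z
  reachable-trans here y⇝z = y⇝z
  reachable-trans (step xv v⇝y) y⇝z = step xv (reachable-trans v⇝y y⇝z)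

  reachable-sym : ∀ {x y} → Reachable G x y → Reachable G y x
  reachable-sym here = here
  reachable-sym (step {v = v} xv v⇝y) =
    reachable-trans (reachable-sym v⇝y) (step (trans (adj-sym G v _) xv) here)

  data ReachableAvoiding (z : Fin n) : Fin n → Fin n → Set where
    here : ∀ {x} → z ≢ x → ReachableAvoiding z x x
    step : ∀ {x v y} → z ≢ x → adj G x v ≡ true → ReachableAvoiding z v y → ReachableAvoiding z x y

  -- Vacuously true when z is x or y, hence the separate z ≢ x, z ≢ y hypotheses below.
  Separates : Fin n → Fin n → Fin n → Set
  Separates z x y = ¬ ReachableAvoiding z x y

  avoiding-source : ∀ {z x y} → ReachableAvoiding z x y → z ≢ x
  avoiding-source (here z≢x) = z≢x
  avoiding-source (step z≢x _ _) = z≢x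

  avoiding-trans : ∀ {z x y w} →
    ReachableAvoiding z x y → ReachableAvoiding z y w → ReachableAvoiding z x w
  avoiding-trans (here _) y⇝w = y⇝w
  avoiding-trans (step z≢x xv v⇝y) y⇝w = step z≢x xv (avoiding-trans v⇝y y⇝w)

  avoiding-snoc : ∀ {z x y w} →
    ReachableAvoiding z x y → adj G y w ≡ true → z ≢ w → ReachableAvoiding z x w
  avoiding-snoc x⇝y yw z≢w = avoiding-trans x⇝y (step (avoiding-target x⇝y) yw (here z≢w))
    where
    avoiding-target : ∀ {z x y} → ReachableAvoiding z x y → z ≢ y
    avoiding-target (here z≢y) = z≢y
    avoiding-target (step _ _ v⇝y) = avoiding-target v⇝y

  avoiding-sym : ∀ {z x y} → ReachableAvoiding z x y → ReachableAvoiding z y x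
  avoiding-sym (here z≢x) = here z≢x
  avoiding-sym (step {v = v} z≢x xv v⇝y) =
    avoiding-snoc (avoiding-sym v⇝y) (trans (adj-sym G v _) xv) z≢x

  separates-sym : ∀ {z x y} → Separates z x y → Separates z y x
  separates-sym z∣xy y⇝x = z∣xy (avoiding-sym y⇝x)

  separates-transport : ∀ {z x y x′ y′} → ReachableAvoiding z x x′ → ReachableAvoiding z y y′ →
    Separates z x y → Separates z x′ y′
  separates-transport x⇝x′ y⇝y′ z∣xy x′⇝y′ =
    z∣xy (avoiding-trans x⇝x′ (avoiding-trans x′⇝y′ (avoiding-sym y⇝y′)))

  separates-≢ : ∀ {z x y w} → Separates z x y → ReachableAvoiding z w y → w ≢ x
  separates-≢ z∣xy w⇝y refl = z∣xy w⇝y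

  separates⇒adjᶜ : ∀ {z x y} → z ≢ x → z ≢ y → Separates z x y → adj Ḡ x y ≡ true
  separates⇒adjᶜ z≢x z≢y z∣xy =
    ¬adj⇒adjᶜ (λ { refl → z∣xy (here z≢x) }) (λ xy → z∣xy (step z≢x xy (here z≢y)))

  avoiding-or-neighbour : ∀ {z x y} → Reachable G x y → z ≢ x →
    ReachableAvoiding z x y ⊎ ∃ λ p → ReachableAvoiding z x p × adj G p z ≡ true
  avoiding-or-neighbour here z≢x = inj₁ (here z≢x)
  avoiding-or-neighbour {z} {x} (step {v = v} xv v⇝y) z≢x with z ≟ v
  ... | yes refl = inj₂ (x , here z≢x , xv)
  ... | no z≢v with avoiding-or-neighbour v⇝y z≢v
  ...   | inj₁ v⇝y∖z = inj₁ (step z≢x xv v⇝y∖z)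
  ...   | inj₂ (p , v⇝p , pz) = inj₂ (p , step z≢x xv v⇝p , pz)

  avoiding-one-of : ∀ {x y s} → Reachable G x y → y ≢ x → s ≢ x → s ≢ y →
    ReachableAvoiding s x y ⊎ ReachableAvoiding y x s
  avoiding-one-of here y≢x _ _ = ⊥-elim (y≢x refl)
  avoiding-one-of {x} {y} {s} (step {v = v} xv v⇝y) y≢x s≢x s≢y with y ≟ v | s ≟ v
  ... | yes refl | _ = inj₁ (step s≢x xv (here s≢y))
  ... | no _ | yes refl = inj₂ (step y≢x xv (here (≢-sym s≢y)))
  ... | no y≢v | no s≢v with avoiding-one-of v⇝y y≢v s≢v s≢y
  ...   | inj₁ v⇝y∖s = inj₁ (step s≢x xv v⇝y∖s)
  ...   | inj₂ v⇝s∖y = inj₂ (step y≢x xv v⇝s∖y)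

  separates⇒avoiding : ∀ {a b c} → a ≢ b → a ≢ c → b ≢ c → Reachable G c a →
    Separates a b c → ReachableAvoiding b c a
  separates⇒avoiding a≢b a≢c b≢c c⇝a a∣bc
    with avoiding-one-of c⇝a a≢c b≢c (≢-sym a≢b)
  ... | inj₁ c⇝a∖b = c⇝a∖b
  ... | inj₂ c⇝b∖a = ⊥-elim (a∣bc (avoiding-sym c⇝b∖a))

  separates⇒separates-neighbours : ∀ {z x y} → z ≢ x → z ≢ y → Reachable G x y → Separates z x y →
    ∃₂ λ p q → adj G z p ≡ true × adj G z q ≡ true × Separates z p q
  separates⇒separates-neighbours {z} z≢x z≢y x⇝y z∣xy
    with avoiding-or-neighbour x⇝y z≢x | avoiding-or-neighbour (reachable-sym x⇝y) z≢y
  ... | inj₁ x⇝y∖z | _ = ⊥-elim (z∣xy x⇝y∖z)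
  ... | inj₂ _ | inj₁ y⇝x∖z = ⊥-elim (z∣xy (avoiding-sym y⇝x∖z))
  ... | inj₂ (p , x⇝p , pz) | inj₂ (q , y⇝q , qz) =
    p , q , trans (adj-sym G z p) pz , trans (adj-sym G z q) qz ,
    separates-transport x⇝p y⇝q z∣xy

  PrivateNeighbour : Fin n → Fin n → Set
  PrivateNeighbour z y = ∃ λ p → adj G z p ≡ true × Separates z p y

  ¬¬privateNeighbour : ∀ {z p q} → adj G z p ≡ true → adj G z q ≡ true → Separates z p q →
    ∀ y → ¬ ¬ PrivateNeighbour z y
  ¬¬privateNeighbour {p = p} {q} zp zq z∣pq y ¬private =
    ¬private (p , zp , λ p⇝y →
      ¬private (q , zq , λ q⇝y → z∣pq (avoiding-trans p⇝y (avoiding-sym q⇝y))))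

  data ShortWalk (x y : Fin n) : Set where
    walk₀ : x ≡ y → ShortWalk x y
    walk₁ : adj G x y ≡ true → ShortWalk x y
    walk₂ : ∀ u → adj G x u ≡ true → adj G u y ≡ true → ShortWalk x y
    walk₃ : ∀ u v → adj G x u ≡ true → adj G u v ≡ true → adj G v y ≡ true → ShortWalk x y

  Interior : ∀ {x y} → Fin n → ShortWalk x y → Set
  Interior z (walk₀ _) = ⊥
  Interior z (walk₁ _) = ⊥
  Interior z (walk₂ u _ _) = u ≡ z
  Interior z (walk₃ u v _ _ _) = u ≡ z ⊎ v ≡ z

  separates⇒interior : ∀ {z x y} → z ≢ x → z ≢ y → Separates z x y →
    (w : ShortWalk x y) → Interior z w
  separates⇒interior z≢x z≢y z∣xy (walk₀ refl) = z∣xy (here z≢x)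
  separates⇒interior z≢x z≢y z∣xy (walk₁ xy) = z∣xy (step z≢x xy (here z≢y))
  separates⇒interior {z} z≢x z≢y z∣xy (walk₂ u xu uy) with u ≟ z
  ... | yes u≡z = u≡z
  ... | no u≢z = ⊥-elim (z∣xy (step z≢x xu (step (≢-sym u≢z) uy (here z≢y))))
  separates⇒interior {z} z≢x z≢y z∣xy (walk₃ u v xu uv vy) with u ≟ z | v ≟ z
  ... | yes u≡z | _ = inj₁ u≡z
  ... | no _ | yes v≡z = inj₂ v≡z
  ... | no u≢z | no v≢z =
    ⊥-elim (z∣xy (step z≢x xu (step (≢-sym u≢z) uv (step (≢-sym v≢z) vy (here z≢y)))))

  interior-adjacent : ∀ {x y b c} → b ≢ c → (w : ShortWalk x y) → Interior b w → Interior c w →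
    adj G b c ≡ true
  interior-adjacent b≢c (walk₂ u _ _) refl refl = ⊥-elim (b≢c refl)
  interior-adjacent b≢c (walk₃ u v _ uv _) (inj₁ refl) (inj₂ refl) = uv
  interior-adjacent b≢c (walk₃ u v _ uv _) (inj₂ refl) (inj₁ refl) = trans (adj-sym G v u) uv
  interior-adjacent b≢c (walk₃ u v _ _ _) (inj₁ refl) (inj₁ refl) = ⊥-elim (b≢c refl)
  interior-adjacent b≢c (walk₃ u v _ _ _) (inj₂ refl) (inj₂ refl) = ⊥-elim (b≢c refl)

  ¬three-interior : ∀ {x y a b c} → a ≢ b → a ≢ c → b ≢ c → (w : ShortWalk x y) →
    Interior a w → Interior b w → Interior c w → ⊥
  ¬three-interior a≢b _ _ (walk₂ u _ _) refl refl _ = a≢b refl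
  ¬three-interior a≢b _ _ (walk₃ u v _ _ _) (inj₁ refl) (inj₁ refl) _ = a≢b refl
  ¬three-interior a≢b _ _ (walk₃ u v _ _ _) (inj₂ refl) (inj₂ refl) _ = a≢b refl
  ¬three-interior _ a≢c _ (walk₃ u v _ _ _) (inj₁ refl) _ (inj₁ refl) = a≢c refl
  ¬three-interior _ a≢c _ (walk₃ u v _ _ _) (inj₂ refl) _ (inj₂ refl) = a≢c refl
  ¬three-interior _ _ b≢c (walk₃ u v _ _ _) _ (inj₁ refl) (inj₁ refl) = b≢c refl
  ¬three-interior _ _ b≢c (walk₃ u v _ _ _) _ (inj₂ refl) (inj₂ refl) = b≢c refl

  module _ (noHouseᶜ : ¬ ContainsInduced Ḡ 5 houseAdj) where

    shortcut : ∀ {x v u w y} → adj G x v ≡ true → adj G v u ≡ true → adj G u w ≡ true →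
      adj G w y ≡ true → ShortWalk x y
    shortcut {x} {v} {u} {w} {y} xv vu uw wy with adjacency x y
    ... | same refl = walk₀ refl
    ... | edge xy = walk₁ xy
    ... | non-edge x̄y with adjacency x w
    ... | same refl = walk₁ wy
    ... | edge xw = walk₂ w xw wy
    ... | non-edge x̄w with adjacency v y
    ... | same refl = walk₁ xv
    ... | edge vy = walk₂ v xv vy
    ... | non-edge v̄y with adjacency x u
    ... | same refl = walk₂ w uw wy
    ... | edge xu = walk₃ u w xu uw wy
    ... | non-edge x̄u with adjacency v w
    ... | same refl = walk₂ v xv wy
    ... | edge vw = walk₃ v w xv vw wy
    ... | non-edge v̄w with adjacency u y
    ... | same refl = walk₂ v xv vu
    ... | edge uy = walk₃ v u xv vu uy
    ... | non-edge ūy = ⊥-elim (noHouseᶜ (inducedP₅⇒houseᶜ xv vu uw wy x̄u x̄w x̄y v̄w v̄y ūy))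

    shortWalk : ∀ {x y} → Reachable G x y → ShortWalk x y
    shortWalk here = walk₀ refl
    shortWalk (step xv v⇝y) with shortWalk v⇝y
    ... | walk₀ refl = walk₁ xv
    ... | walk₁ vy = walk₂ _ xv vy
    ... | walk₂ u vu uy = walk₃ _ u xv vu uy
    ... | walk₃ u w vu uw wy = shortcut xv vu uw wy

    separators-adjacent : ∀ {x y b c} → Reachable G x y → b ≢ c →
      b ≢ x → b ≢ y → Separates b x y → c ≢ x → c ≢ y → Separates c x y → adj G b c ≡ true
    separators-adjacent {x} {y} x⇝y b≢c b≢x b≢y b∣xy c≢x c≢y c∣xy =
      interior-adjacent b≢c w
        (separates⇒interior b≢x b≢y b∣xy w) (separates⇒interior c≢x c≢y c∣xy w)
      where
      w : ShortWalk x y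
      w = shortWalk x⇝y

    ¬three-separators : ∀ {x y a b c} → Reachable G x y → a ≢ b → a ≢ c → b ≢ c →
      a ≢ x → a ≢ y → Separates a x y → b ≢ x → b ≢ y → Separates b x y →
      c ≢ x → c ≢ y → Separates c x y → ⊥
    ¬three-separators {x} {y} x⇝y a≢b a≢c b≢c a≢x a≢y a∣xy b≢x b≢y b∣xy c≢x c≢y c∣xy =
      ¬three-interior a≢b a≢c b≢c w
        (separates⇒interior a≢x a≢y a∣xy w)
        (separates⇒interior b≢x b≢y b∣xy w)
        (separates⇒interior c≢x c≢y c∣xy w)
      where
      w : ShortWalk x y
      w = shortWalk x⇝y

    separator-case : ∀ {a b c} → a ≢ b → a ≢ c → b ≢ c → Reachable G a b → Reachable G a c →
      Separates a b c → PrivateNeighbour b a → PrivateNeighbour c a → ⊥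
    separator-case {a} {b} {c} a≢b a≢c b≢c a⇝b a⇝c a∣bc (e , be , b∣ea) (f , cf , c∣fa) =
      ¬three-separators e⇝f a≢b a≢c b≢c
        a≢e a≢f a∣ef (adj⇒≢ G be) b≢f b∣ef c≢e (adj⇒≢ G cf) c∣ef
      where
      e⇝f : Reachable G e f
      e⇝f = step (trans (adj-sym G e b) be)
              (reachable-trans (reachable-sym a⇝b) (reachable-trans a⇝c (step cf here)))
      c⇝a∖b : ReachableAvoiding b c a
      c⇝a∖b = separates⇒avoiding a≢b a≢c b≢c (reachable-sym a⇝c) a∣bc
      b⇝a∖c : ReachableAvoiding c b a
      b⇝a∖c = separates⇒avoiding a≢c a≢b (≢-sym b≢c) (reachable-sym a⇝b) (separates-sym a∣bc)
      a≢e : a ≢ e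
      a≢e = separates-≢ b∣ea (here (≢-sym a≢b))
      a≢f : a ≢ f
      a≢f = separates-≢ c∣fa (here (≢-sym a≢c))
      b≢f : b ≢ f
      b≢f = separates-≢ c∣fa b⇝a∖c
      c≢e : c ≢ e
      c≢e = separates-≢ b∣ea c⇝a∖b
      a∣ef : Separates a e f
      a∣ef = separates-transport (step a≢b be (here a≢e)) (step a≢c cf (here a≢f)) a∣bc
      b∣ef : Separates b e f
      b∣ef = separates-transport (here (adj⇒≢ G be))
               (avoiding-snoc (avoiding-sym c⇝a∖b) cf b≢f) b∣ea
      c∣ef : Separates c e f
      c∣ef = separates-sym (separates-transport (here (adj⇒≢ G cf))
               (avoiding-snoc (avoiding-sym b⇝a∖c) be c≢e) c∣fa)

    no-separator-case : ¬ ContainsInduced Ḡ 5 gemAdj → ∀ {a b c} → a ≢ b → a ≢ c → b ≢ c →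
      Reachable G b c →
      ReachableAvoiding a b c → ReachableAvoiding b a c → ReachableAvoiding c a b →
      PrivateNeighbour a b → PrivateNeighbour b a → PrivateNeighbour c a → ⊥
    no-separator-case noGemᶜ {a} {b} {c} a≢b a≢c b≢c b⇝c b⇝c∖a a⇝c∖b a⇝b∖c
      (pa , a-pa , a∣pa-b) (pb , b-pb , b∣pb-a) (pc , c-pc , c∣pc-a) =
      noGemᶜ (inducedP₄+K₁⇒gemᶜ (trans (adj-sym G pb b) b-pb) bc c-pc
        (separates⇒adjᶜ b≢pb b≢c b∣pb-c)
        (separates⇒adjᶜ b≢pb b≢pc b∣pb-pc)
        (separates⇒adjᶜ (≢-sym b≢c) c≢pc (separates-sym c∣pc-b))
        (separates⇒adjᶜ a≢pa a≢pb a∣pa-pb)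
        (separates⇒adjᶜ a≢pa a≢b a∣pa-b)
        (separates⇒adjᶜ a≢pa a≢c a∣pa-c)
        (separates⇒adjᶜ a≢pa a≢pc a∣pa-pc))
      where
      a≢pa : a ≢ pa
      a≢pa = adj⇒≢ G a-pa
      b≢pb : b ≢ pb
      b≢pb = adj⇒≢ G b-pb
      c≢pc : c ≢ pc
      c≢pc = adj⇒≢ G c-pc
      a∣pa-c : Separates a pa c
      a∣pa-c = separates-transport (here a≢pa) b⇝c∖a a∣pa-b
      b∣pb-c : Separates b pb c
      b∣pb-c = separates-transport (here b≢pb) a⇝c∖b b∣pb-a
      c∣pc-b : Separates c pc b
      c∣pc-b = separates-transport (here c≢pc) a⇝b∖c c∣pc-a
      a≢pb : a ≢ pb
      a≢pb = separates-≢ b∣pb-a (here (≢-sym a≢b))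
      a≢pc : a ≢ pc
      a≢pc = separates-≢ c∣pc-a (here (≢-sym a≢c))
      b≢pc : b ≢ pc
      b≢pc = separates-≢ c∣pc-b (here (≢-sym b≢c))
      c≢pb : c ≢ pb
      c≢pb = separates-≢ b∣pb-c (here b≢c)
      a∣pa-pb : Separates a pa pb
      a∣pa-pb = separates-transport (here a≢pa) (step a≢b b-pb (here a≢pb)) a∣pa-b
      a∣pa-pc : Separates a pa pc
      a∣pa-pc = separates-transport (here a≢pa) (step a≢c c-pc (here a≢pc)) a∣pa-c
      b∣pb-pc : Separates b pb pc
      b∣pb-pc = separates-transport (here b≢pb) (step b≢c c-pc (here b≢pc)) b∣pb-c
      c∣pc-pb : Separates c pc pb
      c∣pc-pb = separates-transport (here c≢pc) (step (≢-sym b≢c) b-pb (here c≢pb)) c∣pc-b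
      bc : adj G b c ≡ true
      bc = separators-adjacent
        (step (trans (adj-sym G pb b) b-pb) (reachable-trans b⇝c (step c-pc here))) b≢c
        b≢pb b≢pc b∣pb-pc c≢pb c≢pc (separates-sym c∣pc-pb)

avoiding⇒reachable-deleteVertex : ∀ {m} (G : Graph (suc m)) {z x y} → ReachableAvoiding G z x y →
  (z≢x : z ≢ x) (z≢y : z ≢ y) → Reachable (deleteVertex G z) (punchOut z≢x) (punchOut z≢y)
avoiding⇒reachable-deleteVertex G {z} (here _) z≢x z≢y =
  subst (Reachable (deleteVertex G z) (punchOut z≢x)) (punchOut-cong z refl) here
avoiding⇒reachable-deleteVertex G {z} (step {v = v} _ xv v⇝y) z≢x z≢y =
  step (subst₂ (λ s t → adj G s t ≡ true)
               (sym (punchIn-punchOut z≢x)) (sym (punchIn-punchOut z≢v)) xv)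
       (avoiding⇒reachable-deleteVertex G v⇝y z≢v z≢y)
  where
  z≢v : z ≢ v
  z≢v = avoiding-source G v⇝y

-- By pigeonhole, two of the k′ > k components of G − z lie in one component of G.
cutvertex⇒separates : ∀ {n} (G : Graph n) {z} → IsCutvertex G z →
  ∃₂ λ x y → z ≢ x × z ≢ y × Reachable G x y × Separates G z x y
cutvertex⇒separates {suc m} G {z} (k , k′ , (f , _ , f-comp) , (g , g-onto , g-comp) , k<k′)
  with pigeonhole k<k′ (λ c → f (punchIn z (proj₁ (g-onto c))))
... | c₁ , c₂ , c₁<c₂ , fx≡fy = x , y , z≢x , z≢y , proj₁ (f-comp x y) fx≡fy , z∣xy
  where
  i j : Fin m
  i = proj₁ (g-onto c₁)
  j = proj₁ (g-onto c₂)
  x y : Fin (suc m)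
  x = punchIn z i
  y = punchIn z j
  z≢x : z ≢ x
  z≢x = punchInᵢ≢i z i ∘ sym
  z≢y : z ≢ y
  z≢y = punchInᵢ≢i z j ∘ sym
  punchOut-punchIn′ : ∀ {l} (z≢l : z ≢ punchIn z l) → punchOut z≢l ≡ l
  punchOut-punchIn′ _ = trans (punchOut-cong z refl) (punchOut-punchIn z)
  z∣xy : Separates G z x y
  z∣xy x⇝y = <⇒≢ c₁<c₂ (begin
    c₁   ≡⟨ sym (proj₂ (g-onto c₁)) ⟩
    g i  ≡⟨ proj₂ (g-comp i j) i⇝j ⟩
    g j  ≡⟨ proj₂ (g-onto c₂) ⟩
    c₂   ∎)
    where
    open ≡-Reasoning
    i⇝j : Reachable (deleteVertex G z) i j
    i⇝j = subst₂ (Reachable (deleteVertex G z)) (punchOut-punchIn′ z≢x) (punchOut-punchIn′ z≢y)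
            (avoiding⇒reachable-deleteVertex G x⇝y z≢x z≢y)

cutvertex⇒¬¬privateNeighbour : ∀ {n} (G : Graph n) {z} → IsCutvertex G z →
  ∀ y → ¬ ¬ PrivateNeighbour G z y
cutvertex⇒¬¬privateNeighbour G z-cut with cutvertex⇒separates G z-cut
... | x , y , z≢x , z≢y , x⇝y , z∣xy with separates⇒separates-neighbours G z≢x z≢y x⇝y z∣xy
... | p , q , zp , zq , z∣pq = ¬¬privateNeighbour G zp zq z∣pq

mainTheorem5 : (n : ℕ) (G : Graph n) (a b c : Fin n) →
    ¬ a ≡ b → ¬ a ≡ c → ¬ b ≡ c →
    IsCutvertex G a → IsCutvertex G b → IsCutvertex G c →
    Reachable G a b → Reachable G a c →
    ¬ (DistanceHereditary G × DistanceHereditary (complement G))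
mainTheorem5 n G a b c a≢b a≢c b≢c a-cut b-cut c-cut a⇝b a⇝c (_ , _ , noHouseᶜ , _ , noGemᶜ) =
  ¬¬-excluded-middle λ where
    (no a∣bc) → neighbour b-cut a λ pb → neighbour c-cut a λ pc →
      separator-case G noHouseᶜ a≢b a≢c b≢c a⇝b a⇝c a∣bc pb pc
    (yes b⇝c∖a) → ¬¬-excluded-middle λ where
      (no b∣ac) → neighbour a-cut b λ pa → neighbour c-cut b λ pc →
        separator-case G noHouseᶜ (≢-sym a≢b) b≢c a≢c b⇝a b⇝c b∣ac pa pc
      (yes a⇝c∖b) → ¬¬-excluded-middle λ where
        (no c∣ab) → neighbour a-cut c λ pa → neighbour b-cut c λ pb →
          separator-case G noHouseᶜ (≢-sym a≢c) (≢-sym b≢c) a≢b c⇝a c⇝b c∣ab pa pb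
        (yes a⇝b∖c) → neighbour a-cut b λ pa → neighbour b-cut a λ pb → neighbour c-cut a λ pc →
          no-separator-case G noHouseᶜ noGemᶜ a≢b a≢c b≢c b⇝c b⇝c∖a a⇝c∖b a⇝b∖c pa pb pc
  where
  neighbour : ∀ {z} → IsCutvertex G z → ∀ y → ¬ ¬ PrivateNeighbour G z y
  neighbour = cutvertex⇒¬¬privateNeighbour G
  b⇝a : Reachable G b a
  b⇝a = reachable-sym G a⇝b
  c⇝a : Reachable G c a
  c⇝a = reachable-sym G a⇝c
  b⇝c : Reachable G b c
  b⇝c = reachable-trans G b⇝a a⇝c
  c⇝b : Reachable G c b
  c⇝b = reachable-sym G b⇝c
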